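{- Let $N,n\ge0$ be integers. Let $U_N(n)$ be the number of partitions $\pi=(\lambda_1,\lambda_2,\dots)$ with $\mathcal{O}(\pi)=n$ and $\lambda_1\le N$. Let $T_N(n)$ be the number of 2-color partitions (red and green) of $n$ such that the number of red parts plus the size of the largest green part does not exceed $N$. Then $U_N(n)=T_N(n)$.
   Context: A partition is a finite non-increasing sequence of positive integers; the empty sequence is the unique partition of $0$. $\mathcal{O}(\pi)=\lambda_1+\lambda_3+\lambda_5+\cdots$. In a 2-color partition each part is colored red or green; partitions differing in the coloring are distinct. If there are no green parts the size of the largest green part is taken to be $0$. -}

module Defs where

open import Data.Nat using (ℕ; zero; suc; _+_; _≤_; _<_; _≥_)
open import Data.List using (List; []; _∷_; length)
open import Data.Nat.ListAction using (sum)
open import Relation.Binary.PropositionalEquality using (_≡_)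
open import Data.List.Relation.Unary.All using (All)
open import Data.List.Relation.Unary.Linked using (Linked)
open import Data.Product using (Σ; _×_)

IsPartition : List ℕ → Set
IsPartition xs = Linked _≥_ xs × All (0 <_) xs

Partition : Set
Partition = Σ (List ℕ) IsPartition

largest : List ℕ → ℕ
largest []      = 0
largest (x ∷ _) = x

-- O(π) = λ₁ + λ₃ + λ₅ + ⋯   (oddSum),  evenSum = λ₂ + λ₄ + ⋯
oddSum  : List ℕ → ℕ
evenSum : List ℕ → ℕ
oddSum  []       = 0
oddSum  (x ∷ xs) = x + evenSum xs
evenSum []       = 0
evenSum (x ∷ xs) = oddSum xs

O : List ℕ → ℕ
O = oddSum

U-set : ℕ → ℕ → Set
U-set N n = Σ (List ℕ) λ xs → IsPartition xs × (O xs ≡ n) × (largest xs ≤ N)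

T-set : ℕ → ℕ → Set
T-set N n = Σ (List ℕ) λ red → Σ (List ℕ) λ green →
              IsPartition red × IsPartition green ×
              (sum red + sum green ≡ n) × (length red + largest green ≤ N)

-- Read π in pairs (λ₁, λ₂), (λ₃, λ₄), … and build the 2-colour partition from the last
-- pair upwards.  Above a remainder with largest part l, the pair (a, b) adds 1 to every red
-- part, adds b − l new red parts equal to 1, and puts a new largest green part exceeding the
-- old one by a − b.  The quantity #red + (largest green) grows by exactly a − l, so it stays
-- equal to the largest part, and the size grows by a, so it equals O(π).  Each step can be
-- undone, since the red parts equal to 1 are precisely the new ones.

module Submission where

open import Defs
open import Data.Nat using (ℕ; zero; suc; _+_; _*_; _∸_; _≤_; _<_; _≥_; z≤n; s≤s; z<s)
open import Data.Nat.Properties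
open import Data.Nat.Induction using (<-wellFounded)
open import Data.Nat.ListAction using (sum)
open import Data.Nat.Tactic.RingSolver using (solve-∀)
open import Data.List using (List; []; _∷_; length; map; _++_; replicate)
open import Data.List.Properties using (∷-injective; length-replicate)
open import Data.List.Relation.Unary.All using (All; []; _∷_)
open import Data.List.Relation.Unary.Linked as Linked using (Linked; []; [-]; _∷_)
open import Data.Product using (∃; ∃₂; _×_; _,_; proj₁; proj₂)
open import Data.Empty using (⊥-elim)
open import Function.Bundles using (_⤖_; mk⤖)
open import Induction.WellFounded using (Acc; acc)
open import Relation.Binary.PropositionalEquality
open import Relation.Nullary using (Irrelevant)

IsPartition-∷ : ∀ {x xs} → 0 < x → largest xs ≤ x → IsPartition xs → IsPartition (x ∷ xs)
IsPartition-∷ {xs = []}    0<x _   _       = [-] , 0<x ∷ []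
IsPartition-∷ {xs = _ ∷ _} 0<x y≤x (L , A) = y≤x ∷ L , 0<x ∷ A

IsPartition-tail : ∀ {x xs} → IsPartition (x ∷ xs) → IsPartition xs
IsPartition-tail (L , _ ∷ A) = Linked.tail L , A

IsPartition-tail² : ∀ {x y xs} → IsPartition (x ∷ y ∷ xs) → IsPartition xs
IsPartition-tail² p = IsPartition-tail (IsPartition-tail p)

largest-tail≤head : ∀ {x xs} → IsPartition (x ∷ xs) → largest xs ≤ x
largest-tail≤head {xs = []}    _             = z≤n
largest-tail≤head {xs = _ ∷ _} (y≤x ∷ _ , _) = y≤x

largest≡0⇒≡[] : ∀ {xs} → IsPartition xs → largest xs ≡ 0 → xs ≡ []
largest≡0⇒≡[] {[]}    _             _   = refl
largest≡0⇒≡[] {_ ∷ _} (_ , 0<x ∷ _) x≡0 = ⊥-elim (<⇒≢ 0<x (sym x≡0))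

IsPartition-irrelevant : ∀ {xs} → Irrelevant (IsPartition xs)
IsPartition-irrelevant (L , A) (L′ , A′) = cong₂ _,_ (linked L L′) (all A A′)
  where
  linked : ∀ {xs} (L L′ : Linked _≥_ xs) → L ≡ L′
  linked []      []        = refl
  linked [-]     [-]       = refl
  linked (p ∷ L) (p′ ∷ L′) = cong₂ _∷_ (≤-irrelevant p p′) (linked L L′)
  all : ∀ {xs} (A A′ : All (0 <_) xs) → A ≡ A′
  all []      []        = refl
  all (p ∷ A) (p′ ∷ A′) = cong₂ _∷_ (≤-irrelevant p p′) (all A A′)

sum-replicate : ∀ n x → sum (replicate n x) ≡ n * x
sum-replicate zero    x = refl
sum-replicate (suc n) x = cong (x +_) (sum-replicate n x)

consNonZero : ℕ → List ℕ → List ℕ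
consNonZero zero    xs = xs
consNonZero (suc k) xs = suc k ∷ xs

sum-consNonZero : ∀ x xs → sum (consNonZero x xs) ≡ x + sum xs
sum-consNonZero zero    _ = refl
sum-consNonZero (suc _) _ = refl

largest-consNonZero : ∀ {x xs} → largest xs ≤ x → largest (consNonZero x xs) ≡ x
largest-consNonZero {zero}  xs≤0 = n≤0⇒n≡0 xs≤0
largest-consNonZero {suc _} _    = refl

consNonZero-isPartition : ∀ {x xs} → largest xs ≤ x → IsPartition xs →
                          IsPartition (consNonZero x xs)
consNonZero-isPartition {zero}  _    p = p
consNonZero-isPartition {suc _} xs≤x p = IsPartition-∷ z<s xs≤x p

consNonZero-injective : ∀ {x x′ xs xs′} → largest xs ≤ x → largest xs′ ≤ x′ →
                        consNonZero x xs ≡ consNonZero x′ xs′ → x ≡ x′ × xs ≡ xs′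
consNonZero-injective {x} xs≤x xs′≤x′ eq with
  trans (sym (largest-consNonZero xs≤x)) (trans (cong largest eq) (largest-consNonZero xs′≤x′))
... | refl = refl , cancel x eq
  where
  cancel : ∀ x {xs xs′} → consNonZero x xs ≡ consNonZero x xs′ → xs ≡ xs′
  cancel zero    eq = eq
  cancel (suc _) eq = proj₂ (∷-injective eq)

consNonZero-surjective : ∀ {g} → IsPartition g →
                         ∃₂ λ d g₂ → IsPartition g₂ × g ≡ consNonZero (d + largest g₂) g₂
consNonZero-surjective {[]}         _ = 0 , [] , ([] , []) , refl
consNonZero-surjective {zero ∷ _}   (_ , () ∷ _)
consNonZero-surjective {suc k ∷ g₂} p =
  suc k ∸ largest g₂ , g₂ , IsPartition-tail p ,
  cong (λ x → consNonZero x g₂) (sym (m∸n+n≡m (largest-tail≤head p)))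

grow : List ℕ → ℕ → List ℕ
grow r e = map suc r ++ replicate e 1

length-grow : ∀ r e → length (grow r e) ≡ length r + e
length-grow []      e = length-replicate e
length-grow (_ ∷ r) e = cong suc (length-grow r e)

sum-grow : ∀ r e → sum (grow r e) ≡ sum r + length r + e
sum-grow []      e = trans (sum-replicate e 1) (*-identityʳ e)
sum-grow (x ∷ r) e =
  trans (cong (suc x +_) (sum-grow r e)) (regroup x (sum r) (length r) e)
  where
  regroup : ∀ x s l e → suc x + (s + l + e) ≡ x + s + suc l + e
  regroup = solve-∀

largest-grow≤ : ∀ r e {m} → largest r ≤ m → largest (grow r e) ≤ suc m
largest-grow≤ []      zero    _   = z≤n
largest-grow≤ []      (suc _) _   = s≤s z≤n
largest-grow≤ (_ ∷ _) _       x≤m = s≤s x≤m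

largest-grow≤⁻ : ∀ r e {m} → largest (grow r e) ≤ suc m → largest r ≤ m
largest-grow≤⁻ []      _ _         = z≤n
largest-grow≤⁻ (_ ∷ _) _ (s≤s x≤m) = x≤m

replicate-1-isPartition : ∀ n → IsPartition (replicate n 1)
replicate-1-isPartition zero    = [] , []
replicate-1-isPartition (suc n) =
  IsPartition-∷ z<s (largest-grow≤ [] n z≤n) (replicate-1-isPartition n)

grow-isPartition : ∀ {r} e → IsPartition r → IsPartition (grow r e)
grow-isPartition {[]}    e _ = replicate-1-isPartition e
grow-isPartition {_ ∷ r} e p =
  IsPartition-∷ z<s (largest-grow≤ r e (largest-tail≤head p))
                    (grow-isPartition e (IsPartition-tail p))

grow-injective : ∀ {r r′ e e′} → IsPartition r → IsPartition r′ →
                 grow r e ≡ grow r′ e′ → r ≡ r′ × e ≡ e′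
grow-injective {[]} {[]} {e} {e′} _ _ eq =
  refl , trans (sym (length-replicate e)) (trans (cong length eq) (length-replicate e′))
grow-injective {_ ∷ _} {[]} {e′ = suc _} (_ , 0<x ∷ _) _ eq with ∷-injective eq
... | refl , _ = ⊥-elim (<-irrefl refl 0<x)
grow-injective {[]} {_ ∷ _} {suc _} _ (_ , 0<x ∷ _) eq with ∷-injective eq
... | refl , _ = ⊥-elim (<-irrefl refl 0<x)
grow-injective {_ ∷ _} {_ ∷ _} p p′ eq with ∷-injective eq
... | x≡x′ , rest with grow-injective (IsPartition-tail p) (IsPartition-tail p′) rest
... | r≡r′ , e≡e′ = cong₂ _∷_ (suc-injective x≡x′) r≡r′ , e≡e′

all-ones : ∀ {xs} → IsPartition (1 ∷ xs) → xs ≡ replicate (length xs) 1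
all-ones {[]}              _                = refl
all-ones {zero ∷ _}        (_ , _ ∷ () ∷ _)
all-ones {1 ∷ _}           p                = cong (1 ∷_) (all-ones (IsPartition-tail p))
all-ones {suc (suc _) ∷ _} (s≤s () ∷ _ , _)

grow-surjective : ∀ {r} → IsPartition r → ∃₂ λ r₂ e → IsPartition r₂ × r ≡ grow r₂ e
grow-surjective {[]}              _ = [] , 0 , ([] , []) , refl
grow-surjective {zero ∷ _}        (_ , () ∷ _)
grow-surjective {1 ∷ xs}          p = [] , suc (length xs) , ([] , []) , cong (1 ∷_) (all-ones p)
grow-surjective {suc (suc k) ∷ _} p with grow-surjective (IsPartition-tail p)
... | r₂ , e , p₂ , refl =
  suc k ∷ r₂ , e , IsPartition-∷ z<s (largest-grow≤⁻ r₂ e (largest-tail≤head p)) p₂ , refl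

TwoColour : Set
TwoColour = List ℕ × List ℕ

IsTwoColour : TwoColour → Set
IsTwoColour q = IsPartition (proj₁ q) × IsPartition (proj₂ q)

size : TwoColour → ℕ
size q = sum (proj₁ q) + sum (proj₂ q)

bound : TwoColour → ℕ
bound q = length (proj₁ q) + largest (proj₂ q)

step : ℕ → ℕ → TwoColour → TwoColour
step d e (r , g) = grow r e , consNonZero (d + largest g) g

bound-step : ∀ d e q → bound (step d e q) ≡ d + e + bound q
bound-step d e (r , g) = begin
  length (grow r e) + largest (consNonZero (d + largest g) g)
    ≡⟨ cong₂ _+_ (length-grow r e) (largest-consNonZero (m≤n+m (largest g) d)) ⟩
  length r + e + (d + largest g)
    ≡⟨ regroup (length r) e d (largest g) ⟩
  d + e + (length r + largest g) ∎
  where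
  open ≡-Reasoning
  regroup : ∀ l e d m → l + e + (d + m) ≡ d + e + (l + m)
  regroup = solve-∀

size-step : ∀ d e q → size (step d e q) ≡ bound (step d e q) + size q
size-step d e q@(r , g) = begin
  sum (grow r e) + sum (consNonZero (d + largest g) g)
    ≡⟨ cong₂ _+_ (sum-grow r e) (sum-consNonZero (d + largest g) g) ⟩
  sum r + length r + e + (d + largest g + sum g)
    ≡⟨ regroup (sum r) (length r) e d (largest g) (sum g) ⟩
  d + e + bound q + size q
    ≡⟨ cong (_+ size q) (bound-step d e q) ⟨
  bound (step d e q) + size q ∎
  where
  open ≡-Reasoning
  regroup : ∀ s l e d m t → s + l + e + (d + m + t) ≡ d + e + (l + m) + (s + t)
  regroup = solve-∀

step-isTwoColour : ∀ d e {q} → IsTwoColour q → IsTwoColour (step d e q)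
step-isTwoColour d e {_ , g} (pr , pg) =
  grow-isPartition e pr , consNonZero-isPartition (m≤n+m (largest g) d) pg

step-injective : ∀ {d d′ e e′ q q′} → IsTwoColour q → IsTwoColour q′ →
                 step d e q ≡ step d′ e′ q′ → d ≡ d′ × e ≡ e′ × q ≡ q′
step-injective {d} {d′} {q = _ , g} {_ , g′} (pr , _) (pr′ , _) eq
  with grow-injective pr pr′ (cong proj₁ eq)
     | consNonZero-injective (m≤n+m (largest g) d) (m≤n+m (largest g′) d′) (cong proj₂ eq)
... | refl , refl | d+m≡d′+m , refl = +-cancelʳ-≡ (largest g) d d′ d+m≡d′+m , refl , refl

step-surjective : ∀ {q} → IsTwoColour q → ∃₂ λ d e → ∃ λ q₂ → IsTwoColour q₂ × q ≡ step d e q₂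
step-surjective (pr , pg) with grow-surjective pr | consNonZero-surjective pg
... | r₂ , e , pr₂ , refl | d , g₂ , pg₂ , refl = d , e , (r₂ , g₂) , (pr₂ , pg₂) , refl

toTwoColour : List ℕ → TwoColour
toTwoColour []          = [] , []
toTwoColour (a ∷ [])    = step a 0 ([] , [])
toTwoColour (a ∷ b ∷ π) = step (a ∸ b) (b ∸ largest π) (toTwoColour π)

toTwoColour-isTwoColour : ∀ π → IsTwoColour (toTwoColour π)
toTwoColour-isTwoColour []          = ([] , []) , ([] , [])
toTwoColour-isTwoColour (a ∷ [])    = step-isTwoColour a 0 (([] , []) , ([] , []))
toTwoColour-isTwoColour (a ∷ b ∷ π) =
  step-isTwoColour (a ∸ b) (b ∸ largest π) (toTwoColour-isTwoColour π)

bound-toTwoColour : ∀ {π} → IsPartition π → bound (toTwoColour π) ≡ largest π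
bound-toTwoColour {[]}        _ = refl
bound-toTwoColour {a ∷ []}    _ =
  trans (bound-step a 0 ([] , [])) (trans (+-identityʳ (a + 0)) (+-identityʳ a))
bound-toTwoColour {a ∷ b ∷ π} p = begin
  bound (step (a ∸ b) (b ∸ l) (toTwoColour π))
    ≡⟨ bound-step (a ∸ b) (b ∸ l) (toTwoColour π) ⟩
  a ∸ b + (b ∸ l) + bound (toTwoColour π)
    ≡⟨ cong (a ∸ b + (b ∸ l) +_) (bound-toTwoColour (IsPartition-tail² p)) ⟩
  a ∸ b + (b ∸ l) + l
    ≡⟨ +-assoc (a ∸ b) (b ∸ l) l ⟩
  a ∸ b + (b ∸ l + l)
    ≡⟨ cong (a ∸ b +_) (m∸n+n≡m (largest-tail≤head (IsPartition-tail p))) ⟩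
  a ∸ b + b
    ≡⟨ m∸n+n≡m (largest-tail≤head p) ⟩
  a ∎
  where
  open ≡-Reasoning
  l = largest π

size-toTwoColour : ∀ {π} → IsPartition π → size (toTwoColour π) ≡ O π
size-toTwoColour {[]}        _ = refl
size-toTwoColour {a ∷ []}    p = trans (size-step a 0 ([] , [])) (cong (_+ 0) (bound-toTwoColour p))
size-toTwoColour {a ∷ b ∷ π} p = trans (size-step (a ∸ b) (b ∸ largest π) (toTwoColour π))
  (cong₂ _+_ (bound-toTwoColour p) (size-toTwoColour (IsPartition-tail² p)))

toTwoColour-largest-≡ : ∀ {π π′} → IsPartition π → IsPartition π′ →
                        toTwoColour π ≡ toTwoColour π′ → largest π ≡ largest π′
toTwoColour-largest-≡ p p′ eq =
  trans (sym (bound-toTwoColour p)) (trans (cong bound eq) (bound-toTwoColour p′))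

toTwoColour-injective : ∀ {π π′} → IsPartition π → IsPartition π′ →
                        toTwoColour π ≡ toTwoColour π′ → π ≡ π′
toTwoColour-injective {[]}    {[]}    _ _  _  = refl
toTwoColour-injective {[]}    {_ ∷ _} p p′@(_ , 0<a′ ∷ _) eq =
  ⊥-elim (<⇒≢ 0<a′ (toTwoColour-largest-≡ p p′ eq))
toTwoColour-injective {_ ∷ _} {[]}    p@(_ , 0<a ∷ _) p′ eq =
  ⊥-elim (<⇒≢ 0<a (toTwoColour-largest-≡ p′ p (sym eq)))
toTwoColour-injective {_ ∷ []} {_ ∷ []} p p′ eq = cong (_∷ []) (toTwoColour-largest-≡ p p′ eq)
toTwoColour-injective {_ ∷ []} {_ ∷ b′ ∷ π′} p p′@(_ , _ ∷ 0<b′ ∷ _) eq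
  with step-injective (toTwoColour-isTwoColour []) (toTwoColour-isTwoColour π′) eq
... | _ , 0≡b′∸l′ , []≡π′ with toTwoColour-injective ([] , []) (IsPartition-tail² p′) []≡π′
... | refl = ⊥-elim (<⇒≢ 0<b′ 0≡b′∸l′)
toTwoColour-injective {_ ∷ b ∷ π} {_ ∷ []} p@(_ , _ ∷ 0<b ∷ _) p′ eq
  with step-injective (toTwoColour-isTwoColour π) (toTwoColour-isTwoColour []) eq
... | _ , b∸l≡0 , π≡[] with toTwoColour-injective (IsPartition-tail² p) ([] , []) π≡[]
... | refl = ⊥-elim (<⇒≢ 0<b (sym b∸l≡0))
toTwoColour-injective {_ ∷ b ∷ π} {_ ∷ b′ ∷ π′} p p′ eq
  with step-injective (toTwoColour-isTwoColour π) (toTwoColour-isTwoColour π′) eq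
... | _ , b∸l≡b′∸l , π≡π′
  with toTwoColour-injective (IsPartition-tail² p) (IsPartition-tail² p′) π≡π′
... | refl
  with ∸-cancelʳ-≡ (largest-tail≤head (IsPartition-tail p)) (largest-tail≤head (IsPartition-tail p′))
                   b∸l≡b′∸l
... | refl = cong (_∷ b ∷ π) (toTwoColour-largest-≡ p p′ eq)

consPair : ℕ → ℕ → List ℕ → List ℕ
consPair d e π = d + b ∷ consNonZero b π
  where b = e + largest π

consPair-isPartition : ∀ {d e π} → 0 < d + e + largest π → IsPartition π →
                       IsPartition (consPair d e π)
consPair-isPartition {d} {e} {π} 0<d+e+l p =
  IsPartition-∷ (subst (0 <_) (+-assoc d e (largest π)) 0<d+e+l)
                (≤-trans (≤-reflexive (largest-consNonZero π≤b)) (m≤n+m b d))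
                (consNonZero-isPartition π≤b p)
  where
  b = e + largest π
  π≤b = m≤n+m (largest π) e

toTwoColour-consPair : ∀ d e {π} → IsPartition π →
                       toTwoColour (consPair d e π) ≡ step d e (toTwoColour π)
toTwoColour-consPair d e {π} p = begin
  toTwoColour (d + b ∷ consNonZero b π)
    ≡⟨ toTwoColour-∷-consNonZero (d + b) (m≤n+m (largest π) e) ⟩
  step (d + b ∸ b) (b ∸ largest π) (toTwoColour π)
    ≡⟨ cong₂ (λ d′ e′ → step d′ e′ (toTwoColour π)) (m+n∸n≡m d b) (m+n∸n≡m e (largest π)) ⟩
  step d e (toTwoColour π) ∎
  where
  open ≡-Reasoning
  b = e + largest π
  toTwoColour-∷-consNonZero : ∀ a {b} → largest π ≤ b →
    toTwoColour (a ∷ consNonZero b π) ≡ step (a ∸ b) (b ∸ largest π) (toTwoColour π)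
  toTwoColour-∷-consNonZero a {zero}  π≤0 rewrite largest≡0⇒≡[] p (n≤0⇒n≡0 π≤0) = refl
  toTwoColour-∷-consNonZero a {suc _} _   = refl

Preimage : TwoColour → Set
Preimage q = ∃ λ π → IsPartition π × toTwoColour π ≡ q

preimage : ∀ {q} → IsTwoColour q → Acc _<_ (size q) → Preimage q
preimage-of-nonempty : ∀ {q} → IsTwoColour q → 0 < bound q → Acc _<_ (size q) → Preimage q

preimage {[] , []}    _                       _  = [] , ([] , []) , refl
preimage {[] , _ ∷ _} tc@(_ , (_ , 0<x ∷ _)) rs = preimage-of-nonempty tc 0<x rs
preimage {_ ∷ _ , _}  tc                      rs = preimage-of-nonempty tc z<s rs

preimage-of-nonempty tc 0<bound (acc rs) with step-surjective tc
... | d , e , q₂ , tc₂ , refl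
  with preimage tc₂ (rs (subst (size q₂ <_) (sym (size-step d e q₂)) (m<n+m (size q₂) 0<bound)))
... | π , p , refl = consPair d e π , consPair-isPartition 0<d+e+l p , toTwoColour-consPair d e p
  where
  0<d+e+l : 0 < d + e + largest π
  0<d+e+l = subst (0 <_) (trans (bound-step d e (toTwoColour π)) (cong (d + e +_) (bound-toTwoColour p))) 0<bound

toTwoColour-surjective : ∀ {q} → IsTwoColour q → Preimage q
toTwoColour-surjective tc = preimage tc (<-wellFounded _)

U-set-≡ : ∀ {N n} {x y : U-set N n} → proj₁ x ≡ proj₁ y → x ≡ y
U-set-≡ {x = _ , p , e , l} {_ , p′ , e′ , l′} refl
  rewrite IsPartition-irrelevant p p′ | ≡-irrelevant e e′ | ≤-irrelevant l l′ = refl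

T-set-≡ : ∀ {N n} {x y : T-set N n} →
          proj₁ x ≡ proj₁ y → proj₁ (proj₂ x) ≡ proj₁ (proj₂ y) → x ≡ y
T-set-≡ {x = _ , _ , pr , pg , e , l} {_ , _ , pr′ , pg′ , e′ , l′} refl refl
  rewrite IsPartition-irrelevant pr pr′ | IsPartition-irrelevant pg pg′
        | ≡-irrelevant e e′ | ≤-irrelevant l l′ = refl

U⇒T : ∀ {N n} → U-set N n → T-set N n
U⇒T {N} (π , p , O≡n , π≤N) =
  proj₁ (toTwoColour π) , proj₂ (toTwoColour π) ,
  proj₁ (toTwoColour-isTwoColour π) , proj₂ (toTwoColour-isTwoColour π) ,
  trans (size-toTwoColour p) O≡n , subst (_≤ N) (sym (bound-toTwoColour p)) π≤N

theorem3p4 : (N n : ℕ) → U-set N n ⤖ T-set N n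
theorem3p4 N n = mk⤖ {to = U⇒T} (injective , surjective)
  where
  injective : ∀ {x y} → U⇒T x ≡ U⇒T y → x ≡ y
  injective {_ , p , _} {_ , p′ , _} eq =
    U-set-≡ (toTwoColour-injective p p′ (cong (λ t → proj₁ t , proj₁ (proj₂ t)) eq))
  surjective : ∀ t → ∃ λ x → ∀ {z} → z ≡ x → U⇒T z ≡ t
  surjective (_ , _ , pr , pg , size≡n , bound≤N) with toTwoColour-surjective (pr , pg)
  ... | π , p , refl = x , λ { refl → T-set-≡ refl refl }
    where
    x : U-set N n
    x = π , p , trans (sym (size-toTwoColour p)) size≡n ,
        subst (_≤ N) (bound-toTwoColour p) bound≤N
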